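{- For every positive integer $n$, $$\sum_{k=1}^n\frac{H_k^4+6H_k^2H_k^{(2)}+8H_kH_k^{(3)}+3\left(H_k^{(2)}\right)^2+6H_k^{(4)}}{k}=\frac{1}{5}\Big\{H_n^5+10H_n^3H_n^{(2)}+20H_n^2H_n^{(3)}+15H_n\left(H_n^{(2)}\right)^2+30H_nH_n^{(4)}+20H_n^{(2)}H_n^{(3)}+24H_n^{(5)}\Big\}.$$
   Context: $H_n^{(r)}=\sum_{k=1}^n k^{ -r}$ and $H_n=H_n^{(1)}$. -}

module Defs where

open import Data.Nat as ℕ using (ℕ; zero; suc)
open import Data.Nat.Properties using (m^n≢0)
open import Data.Integer using (+_)
open import Data.Rational using (ℚ; 0ℚ; _+_; _*_; _/_)

-- 1 / k^r as a rational, for k ≥ 1 (written k = suc j)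
invPow : (r j : ℕ) → ℚ
invPow r j = _/_ (+ 1) (suc j ℕ.^ r) {{m^n≢0 (suc j) r}}

H : (r n : ℕ) → ℚ
H r zero    = 0ℚ
H r (suc n) = H r n + invPow r n

-- Σ_{k=1}^n f k, where the summand receives j with k = suc j
Σ₁ : ℕ → (ℕ → ℚ) → ℚ
Σ₁ zero    f = 0ℚ
Σ₁ (suc n) f = Σ₁ n f + f n

_^ℚ_ : ℚ → ℕ → ℚ
x ^ℚ zero  = Data.Rational.1ℚ
x ^ℚ suc m = x * (x ^ℚ m)

-- Write a, b, c, d, e for H_n, H_n^(2), …, H_n^(5), let T(a,b,c,d,e) be the
-- right-hand side of the theorem and S(a,b,c,d) the numerator of its summand.
-- The identity has nothing to do with 1/k specifically: passing from n to n+1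
-- adds x, x², x³, x⁴, x⁵ to a, …, e (here x = 1/(n+1)), and the polynomial
-- identity
--     T(a+x, b+x², c+x³, d+x⁴, e+x⁵) = T(a,b,c,d,e) + S(a+x, b+x², c+x³, d+x⁴)·x
-- holds in any commutative ring containing 1/5.  Hence for the power sums of
-- ANY rational sequence, T telescopes to the sum of the S-terms.
module Submission where

open import Data.Nat using (ℕ; zero; suc; NonZero)
import Data.Nat as ℕ
open import Data.Nat.Properties using (m*n≢0; m^n≢0)
open import Data.Integer using (+_)
open import Data.Rational using (ℚ; 0ℚ; 1ℚ; _+_; _*_; _/_; toℚᵘ)
open import Data.Rational.Properties
  using (toℚᵘ-injective; toℚᵘ-fromℚᵘ; toℚᵘ-homo-*; *-identityʳ)
import Data.Rational.Unnormalised as ℚᵘ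
import Data.Rational.Unnormalised.Properties as ℚᵘP
open import Data.Rational.Solver using (module +-*-Solver)
open import Relation.Binary.PropositionalEquality
  using (_≡_; refl; sym; cong; cong₂; module ≡-Reasoning)

open import Defs

-- Instantiated at ℚ they unfold to exactly the expressions of the statement;
-- instantiated at the solver's polynomial syntax they can be normalised.
module Polynomials {A : Set} (plus times : A → A → A) (k : ℚ → A) where

  infixl 6 _⊕_
  infixl 7 _⊗_

  _⊕_ _⊗_ : A → A → A
  _⊕_ = plus
  _⊗_ = times

  pow : A → ℕ → A
  pow x zero    = k 1ℚ
  pow x (suc m) = x ⊗ pow x m

  S : A → A → A → A → A
  S a b c d = pow a 4 ⊕ k (+ 6 / 1) ⊗ pow a 2 ⊗ b ⊕ k (+ 8 / 1) ⊗ a ⊗ c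
              ⊕ k (+ 3 / 1) ⊗ pow b 2 ⊕ k (+ 6 / 1) ⊗ d

  T : A → A → A → A → A → A
  T a b c d e = k (+ 1 / 5) ⊗ (pow a 5 ⊕ k (+ 10 / 1) ⊗ pow a 3 ⊗ b
                               ⊕ k (+ 20 / 1) ⊗ pow a 2 ⊗ c
                               ⊕ k (+ 15 / 1) ⊗ a ⊗ pow b 2
                               ⊕ k (+ 30 / 1) ⊗ a ⊗ d
                               ⊕ k (+ 20 / 1) ⊗ b ⊗ c
                               ⊕ k (+ 24 / 1) ⊗ e)

open Polynomials _+_ _*_ (λ q → q)

T-increment : ∀ a b c d e x →
  T (a + x ^ℚ 1) (b + x ^ℚ 2) (c + x ^ℚ 3) (d + x ^ℚ 4) (e + x ^ℚ 5)
    ≡ T a b c d e + S (a + x ^ℚ 1) (b + x ^ℚ 2) (c + x ^ℚ 3) (d + x ^ℚ 4) * x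
T-increment = solve 6 (λ a b c d e x →
    Syntax.T (a :+ Syntax.pow x 1) (b :+ Syntax.pow x 2) (c :+ Syntax.pow x 3)
             (d :+ Syntax.pow x 4) (e :+ Syntax.pow x 5)
      := Syntax.T a b c d e
         :+ Syntax.S (a :+ Syntax.pow x 1) (b :+ Syntax.pow x 2) (c :+ Syntax.pow x 3)
                     (d :+ Syntax.pow x 4) :* x)
  refl
  where
  open +-*-Solver using (solve; _:=_; con; _:+_; _:*_)
  module Syntax = Polynomials _:+_ _:*_ con

Σ₁-telescope : (F f : ℕ → ℚ) → F 0 ≡ 0ℚ → (∀ n → F (suc n) ≡ F n + f n) →
               ∀ n → Σ₁ n f ≡ F n
Σ₁-telescope F f F0 step zero    = sym F0
Σ₁-telescope F f F0 step (suc n) = begin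
  Σ₁ n f + f n  ≡⟨ cong (_+ f n) (Σ₁-telescope F f F0 step n) ⟩
  F n + f n     ≡⟨ sym (step n) ⟩
  F (suc n)     ∎
  where open ≡-Reasoning

powerSum-identity : (x : ℕ → ℚ) (p : ℕ → ℕ → ℚ) →
  (∀ r → p r 0 ≡ 0ℚ) → (∀ r n → p r (suc n) ≡ p r n + x n ^ℚ r) → ∀ n →
  Σ₁ n (λ j → S (p 1 (suc j)) (p 2 (suc j)) (p 3 (suc j)) (p 4 (suc j)) * x j)
    ≡ T (p 1 n) (p 2 n) (p 3 n) (p 4 n) (p 5 n)
powerSum-identity x p p0 p-suc =
  Σ₁-telescope (λ n → T (p 1 n) (p 2 n) (p 3 n) (p 4 n) (p 5 n)) _
    (T-at-zero (p0 1) (p0 2) (p0 3) (p0 4) (p0 5))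
    (λ n → T-step {p 1 n} {p 2 n} {p 3 n} {p 4 n} {p 5 n} {y = x n}
             (p-suc 1 n) (p-suc 2 n) (p-suc 3 n) (p-suc 4 n) (p-suc 5 n))
  where
  T-at-zero : ∀ {a b c d e} → a ≡ 0ℚ → b ≡ 0ℚ → c ≡ 0ℚ → d ≡ 0ℚ → e ≡ 0ℚ →
              T a b c d e ≡ 0ℚ
  T-at-zero refl refl refl refl refl = refl

  T-step : ∀ {a b c d e a′ b′ c′ d′ e′ y} →
    a′ ≡ a + y ^ℚ 1 → b′ ≡ b + y ^ℚ 2 → c′ ≡ c + y ^ℚ 3 →
    d′ ≡ d + y ^ℚ 4 → e′ ≡ e + y ^ℚ 5 →
    T a′ b′ c′ d′ e′ ≡ T a b c d e + S a′ b′ c′ d′ * y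
  T-step {a} {b} {c} {d} {e} {y = y} refl refl refl refl refl = T-increment a b c d e y

-- Unit fractions multiply: 1/(mn) = (1/m)(1/n).  A rational m/n is the
-- normalisation of the unnormalised fraction m/n, and for unnormalised
-- fractions the identity holds by computation.
unitFraction-* : ∀ m n .{{_ : NonZero m}} .{{_ : NonZero n}} →
                 (+ 1 / (m ℕ.* n)) {{m*n≢0 m n}} ≡ (+ 1 / m) * (+ 1 / n)
unitFraction-* m@(suc _) n@(suc _) = toℚᵘ-injective (begin
  toℚᵘ (+ 1 / (m ℕ.* n))                  ≈⟨ toℚᵘ-fromℚᵘ (+ 1 ℚᵘ./ (m ℕ.* n)) ⟩
  (+ 1 ℚᵘ./ m) ℚᵘ.* (+ 1 ℚᵘ./ n)          ≈⟨ ℚᵘP.*-cong (ℚᵘP.≃-sym (toℚᵘ-fromℚᵘ (+ 1 ℚᵘ./ m)))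
                                                      (ℚᵘP.≃-sym (toℚᵘ-fromℚᵘ (+ 1 ℚᵘ./ n))) ⟩
  toℚᵘ (+ 1 / m) ℚᵘ.* toℚᵘ (+ 1 / n)      ≈⟨ ℚᵘP.≃-sym (toℚᵘ-homo-* (+ 1 / m) (+ 1 / n)) ⟩
  toℚᵘ ((+ 1 / m) * (+ 1 / n))            ∎)
  where open ℚᵘP.≃-Reasoning

invPow-one : ∀ j → invPow 1 j ≡ + 1 / suc j
invPow-one j = begin
  invPow 1 j                    ≡⟨ unitFraction-* (suc j) 1 ⟩
  (+ 1 / suc j) * 1ℚ            ≡⟨ *-identityʳ (+ 1 / suc j) ⟩
  + 1 / suc j                   ∎
  where open ≡-Reasoning

-- 1/k^r = (1/k)^r, so H^(r) is the r-th power sum of the sequence 1/(j+1)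
invPow-pow : ∀ r j → invPow r j ≡ invPow 1 j ^ℚ r
invPow-pow zero    j = refl
invPow-pow (suc r) j = begin
  invPow (suc r) j              ≡⟨ unitFraction-* (suc j) (suc j ℕ.^ r) {{_}} {{m^n≢0 (suc j) r}} ⟩
  (+ 1 / suc j) * invPow r j    ≡⟨ cong₂ _*_ (sym (invPow-one j)) (invPow-pow r j) ⟩
  invPow 1 j * invPow 1 j ^ℚ r  ∎
  where open ≡-Reasoning

mainTheorem17 : (n : ℕ) → 1 Data.Nat.≤ n →
    Σ₁ n (λ j → ((H 1 (suc j) ^ℚ 4) + ((+ 6 / 1) * (H 1 (suc j) ^ℚ 2) * H 2 (suc j))
                  + ((+ 8 / 1) * H 1 (suc j) * H 3 (suc j)) + ((+ 3 / 1) * (H 2 (suc j) ^ℚ 2))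
                  + ((+ 6 / 1) * H 4 (suc j))) * invPow 1 j)
    ≡ (+ 1 / 5) * ((H 1 n ^ℚ 5) + ((+ 10 / 1) * (H 1 n ^ℚ 3) * H 2 n)
                  + ((+ 20 / 1) * (H 1 n ^ℚ 2) * H 3 n)
                  + ((+ 15 / 1) * H 1 n * (H 2 n ^ℚ 2))
                  + ((+ 30 / 1) * H 1 n * H 4 n)
                  + ((+ 20 / 1) * H 2 n * H 3 n)
                  + ((+ 24 / 1) * H 5 n))
mainTheorem17 n _ = powerSum-identity (invPow 1) H (λ r → refl) H-suc n
  where
  H-suc : ∀ r m → H r (suc m) ≡ H r m + invPow 1 m ^ℚ r
  H-suc r m = cong (λ y → H r m + y) (invPow-pow r m)
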